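{- Let $X$, $Y$ be finite nonempty sets, $F: X\to 2^Y$ a set-valued mapping admitting a Hall partition $(W_1,\ldots,W_m)$, and let $s$ be an alldifferent selection of $F$. Then for each $i=1,\ldots,m$, the restriction of $s$ to $W_i\cup\cdots\cup W_m$ is an alldifferent selection of $F_{W_1\cup\cdots\cup W_{i-1}}$.
   Context: A set-valued mapping $F: X \to 2^Y$ assigns to each $x$ a (possibly empty) subset $F(x) \subset Y$; $F(W) = \bigcup_{x\in W}F(x)$; $\sharp$ is cardinality. A selection of a set-valued $G$ with domain $D$ is $s: D\to Y$ with $s(x)\in G(x)$ for all $x\in D$; alldifferent means injective. For $W \subset X$, $F_W: X\setminus W \to 2^Y$ is $F_W(x) = F(x) \setminus F(W)$ ($F_\emptyset=F$). For set-valued $G$ on a finite set, a subset $W$ of its domain is critical for $G$ if $W\ne\emptyset$ and $\sharp G(W)=\sharp W$; non-reducible for $G$ if $W\ne\emptyset$ and no proper subset of $W$ is critical for $G$. A tuple $(W_1,\ldots,W_m)$, $m\ge1$, is a Hall partition of $F$ if the $W_i$ are nonempty, pairwise disjoint with union $X$, and with $G_i = F_{W_1\cup\cdots\cup W_{i-1}}$ ($G_1=F$): (i) $G_i(x)\neq\emptyset$ for $x \in W_i$; (ii) $W_i$ is non-reducible for $G_i$; (iii) $W_i$ is critical for $G_i$ for $i \le m-1$. -}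

module Defs where

open import Data.Nat using (ℕ; suc; _<ᵇ_; _≤ᵇ_; _<_; _≡ᵇ_)
open import Data.Bool using (if_then_else_)
open import Data.Fin using (Fin; toℕ)
open import Data.Fin.Subset using (Subset; ⊥; ⊤; _∪_; _─_; ⋃; _∈_; _∉_; _⊂_; ∣_∣; Nonempty)
open import Data.List using (List; map; allFin)
open import Data.Vec using (lookup)
open import Data.Product using (_×_; Σ)
open import Relation.Binary.PropositionalEquality using (_≡_)
open import Relation.Nullary using (¬_)

SetValued : ℕ → ℕ → Set
SetValued n k = Fin n → Subset k

image : ∀ {n k} → SetValued n k → Subset n → Subset k
image {n} F W = ⋃ (map (λ x → if lookup W x then F x else ⊥) (allFin n))

-- F_W (x) = F(x) \ F(W); its domain is X \ W (represented by ∁ W).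
reduce : ∀ {n k} → SetValued n k → Subset n → SetValued n k
reduce F W x = F x ─ image F W

Critical : ∀ {n k} → SetValued n k → Subset n → Set
Critical G W = Nonempty W × ∣ image G W ∣ ≡ ∣ W ∣

NonReducible : ∀ {n k} → SetValued n k → Subset n → Set
NonReducible G W = Nonempty W × (∀ V → V ⊂ W → ¬ Critical G V)

-- W_1 ∪ ... ∪ W_{i-1}  (0-based: union of W j with j < i)
prefix : ∀ {n m} → (Fin m → Subset n) → Fin m → Subset n
prefix {n} {m} W i = ⋃ (map (λ j → if toℕ j <ᵇ toℕ i then W j else ⊥) (allFin m))

-- W_i ∪ ... ∪ W_m  (0-based: union of W j with i ≤ j)
suffix : ∀ {n m} → (Fin m → Subset n) → Fin m → Subset n
suffix {n} {m} W i = ⋃ (map (λ j → if toℕ i ≤ᵇ toℕ j then W j else ⊥) (allFin m))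

record HallPartition {n k m : ℕ} (F : SetValued n k) (W : Fin m → Subset n) : Set where
  field
    m-pos      : 0 < m
    nonempty   : ∀ i → Nonempty (W i)
    disjoint   : ∀ i j x → x ∈ W i → x ∈ W j → i ≡ j
    covers     : ∀ x → Σ (Fin m) (λ i → x ∈ W i)
    cond-i     : ∀ i x → x ∈ W i → Nonempty (reduce F (prefix W i) x)
    cond-ii    : ∀ i → NonReducible (reduce F (prefix W i)) (W i)
    -- (iii) W_i critical for G_i for i ≤ m-1 (1-based), i.e. toℕ i + 1 < m
    cond-iii   : ∀ i → suc (toℕ i) < m → Critical (reduce F (prefix W i)) (W i)

IsSelectionOn : ∀ {n k} → Subset n → SetValued n k → (Fin n → Fin k) → Set
IsSelectionOn D G s = ∀ x → x ∈ D → s x ∈ G x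

AllDifferentOn : ∀ {n k} → Subset n → (Fin n → Fin k) → Set
AllDifferentOn D s = ∀ x y → x ∈ D → y ∈ D → s x ≡ s y → x ≡ y

{-# OPTIONS --safe #-}

-- Suppose no point outside W₁ ∪ … ∪ Wᵢ₋₁ is
-- sent by s into F(W₁ ∪ … ∪ Wᵢ₋₁).  Then s is an injective selection of Gᵢ on
-- Wᵢ, so it maps Wᵢ injectively into Gᵢ(Wᵢ); when Wᵢ is critical both sets
-- have the same size, the map is onto, and no point outside Wᵢ can take a value
-- in Gᵢ(Wᵢ).  Hence no point outside W₁ ∪ … ∪ Wᵢ is sent into F(W₁ ∪ … ∪ Wᵢ).

module Submission where

open import Defs
open import Data.Nat using (ℕ; suc; zero; _<ᵇ_; _≤ᵇ_; _<_; _≤_; _≤?_; z≤n; s≤s)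
open import Data.Nat.Properties
  using (<ᵇ⇒<; <⇒<ᵇ; ≤ᵇ⇒≤; ≤⇒≤ᵇ; <-irrefl; <-trans; <-≤-trans; ≤-<-trans; n<1+n; n≤1+n;
         m<1+n⇒m<n∨m≡n; ≰⇒>)
open import Data.Bool using (Bool; true; false; if_then_else_; T)
open import Data.Bool.Properties using (T-≡)
open import Data.Fin using (Fin; toℕ)
import Data.Fin.Base as Fin
open import Data.Fin.Properties using (suc-injective; toℕ<n)
open import Data.Fin.Subset using (Subset; ⊤; ⊥; _∈_; _∉_; ⋃; ∣_∣; outside; inside; _-_)
open import Data.Fin.Subset.Properties
  using (∉⊥; ∈⊤; x∈p∪q⁻; x∈p∪q⁺; x∈p∧x∉q⇒x∈p─q; x∈p∧x≢y⇒x∈p-y; x∈p⇒∣p-x∣<∣p∣; _∈?_)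
open import Data.Vec using (_∷_; []; lookup; here; there)
open import Data.Vec.Properties using (lookup⇒[]=; []=⇒lookup)
open import Data.List using (List; map; allFin) renaming (_∷_ to _∷ₗ_; [] to []ₗ)
open import Data.List.Relation.Unary.Any using (here; there)
import Data.List.Membership.Propositional as List
open import Data.List.Membership.Propositional.Properties using (∈-allFin)
open import Data.Product using (_×_; _,_; ∃; proj₂)
open import Data.Sum using (_⊎_; inj₁; inj₂)
open import Data.Empty using (⊥-elim)
open import Function using (_∘_)
open import Function.Bundles using (_⇔_; mk⇔; Equivalence)
open import Relation.Binary.PropositionalEquality using (_≡_; refl; subst)
open import Relation.Nullary using (yes; no)
open import Relation.Nullary.Negation using (contradiction)

∈-⋃-map⁻ : ∀ {n} {A : Set} (g : A → Subset n) (as : List A) {y}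
         → y ∈ ⋃ (map g as) → ∃ λ a → y ∈ g a
∈-⋃-map⁻ g []ₗ       y∈ = ⊥-elim (∉⊥ y∈)
∈-⋃-map⁻ g (a ∷ₗ as) y∈ with x∈p∪q⁻ (g a) (⋃ (map g as)) y∈
... | inj₁ y∈ga = a , y∈ga
... | inj₂ y∈as = ∈-⋃-map⁻ g as y∈as

∈-⋃-map⁺ : ∀ {n} {A : Set} (g : A → Subset n) {as : List A} {a y}
         → a List.∈ as → y ∈ g a → y ∈ ⋃ (map g as)
∈-⋃-map⁺ g (here refl) y∈ga = x∈p∪q⁺ (inj₁ y∈ga)
∈-⋃-map⁺ g (there a∈)  y∈ga = x∈p∪q⁺ (inj₂ (∈-⋃-map⁺ g a∈ y∈ga))

∈-if-then-⊥⁻ : ∀ {n} c {p : Subset n} {y} → y ∈ (if c then p else ⊥) → T c × y ∈ p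
∈-if-then-⊥⁻ true  y∈ = _ , y∈
∈-if-then-⊥⁻ false y∈ = ⊥-elim (∉⊥ y∈)

∈-if-then-⊥⁺ : ∀ {n} c {p : Subset n} {y} → T c → y ∈ p → y ∈ (if c then p else ⊥)
∈-if-then-⊥⁺ true _ y∈ = y∈

⋃[_∣_] : ∀ {n m} → (Fin m → Bool) → (Fin m → Subset n) → Subset n
⋃[_∣_] {m = m} b g = ⋃ (map (λ j → if b j then g j else ⊥) (allFin m))

∈-⋃[∣]⁻ : ∀ {n m} (b : Fin m → Bool) (g : Fin m → Subset n) {y}
        → y ∈ ⋃[ b ∣ g ] → ∃ λ j → T (b j) × y ∈ g j
∈-⋃[∣]⁻ {m = m} b g y∈ with ∈-⋃-map⁻ (λ j → if b j then g j else ⊥) (allFin m) y∈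
... | j , y∈j = j , ∈-if-then-⊥⁻ (b j) y∈j

∈-⋃[∣]⁺ : ∀ {n m} (b : Fin m → Bool) (g : Fin m → Subset n) {j y}
        → T (b j) → y ∈ g j → y ∈ ⋃[ b ∣ g ]
∈-⋃[∣]⁺ b g {j} bj y∈ =
  ∈-⋃-map⁺ (λ j → if b j then g j else ⊥) (∈-allFin j) (∈-if-then-⊥⁺ (b j) bj y∈)

module _ {n k : ℕ} (F : SetValued n k) where

  ∈-image⁻ : ∀ V {y} → y ∈ image F V → ∃ λ x → x ∈ V × y ∈ F x
  ∈-image⁻ V y∈ with ∈-⋃[∣]⁻ (lookup V) F y∈
  ... | x , Vx , y∈Fx = x , lookup⇒[]= x V (Equivalence.to T-≡ Vx) , y∈Fx

  ∈-image⁺ : ∀ {V x y} → x ∈ V → y ∈ F x → y ∈ image F V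
  ∈-image⁺ {V} x∈V = ∈-⋃[∣]⁺ (lookup V) F (Equivalence.from T-≡ ([]=⇒lookup x∈V))

∈-image-reduce : ∀ {n k} (F : SetValued n k) U V {y}
               → y ∈ image F V → y ∉ image F U → y ∈ image (reduce F U) V
∈-image-reduce F U V y∈ y∉ with ∈-image⁻ F V y∈
... | x , x∈V , y∈Fx = ∈-image⁺ (reduce F U) x∈V (x∈p∧x∉q⇒x∈p─q y∈Fx y∉)

injectiveOn⇒∣p∣≤∣q∣ : ∀ {n k} (p : Subset n) (q : Subset k) (f : Fin n → Fin k)
                    → (∀ x → x ∈ p → f x ∈ q) → AllDifferentOn p f → ∣ p ∣ ≤ ∣ q ∣
injectiveOn⇒∣p∣≤∣q∣ []            q f into inj = z≤n
injectiveOn⇒∣p∣≤∣q∣ (outside ∷ p) q f into inj =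
  injectiveOn⇒∣p∣≤∣q∣ p q (f ∘ Fin.suc) (λ x → into _ ∘ there)
    (λ x y x∈ y∈ → suc-injective ∘ inj _ _ (there x∈) (there y∈))
injectiveOn⇒∣p∣≤∣q∣ (inside ∷ p) q f into inj =
  <-≤-trans (s≤s (injectiveOn⇒∣p∣≤∣q∣ p (q - f Fin.zero) (f ∘ Fin.suc) into′
                   (λ x y x∈ y∈ → suc-injective ∘ inj _ _ (there x∈) (there y∈))))
            (x∈p⇒∣p-x∣<∣p∣ (into Fin.zero here))
  where
  into′ : ∀ x → x ∈ p → f (Fin.suc x) ∈ q - f Fin.zero
  into′ x x∈ = x∈p∧x≢y⇒x∈p-y (into _ (there x∈))
                              (λ e → contradiction (inj _ _ (there x∈) here e) λ ())

critical⇒∉image : ∀ {n k} (G : SetValued n k) (V : Subset n) (s : Fin n → Fin k)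
                → ∣ image G V ∣ ≡ ∣ V ∣ → IsSelectionOn V G s → AllDifferentOn ⊤ s
                → ∀ x → x ∉ V → s x ∉ image G V
critical⇒∉image G V s crit sel inj x x∉V sx∈ = <-irrefl refl (≤-<-trans ∣V∣≤ ∣image-sx∣<∣V∣)
  where
  ∣V∣≤ : ∣ V ∣ ≤ ∣ image G V - s x ∣
  ∣V∣≤ = injectiveOn⇒∣p∣≤∣q∣ V (image G V - s x) s
    (λ a a∈V → x∈p∧x≢y⇒x∈p-y (∈-image⁺ G a∈V (sel a a∈V))
                              (λ e → x∉V (subst (_∈ V) (inj a x ∈⊤ ∈⊤ e) a∈V)))
    (λ a b _ _ → inj a b ∈⊤ ∈⊤)
  ∣image-sx∣<∣V∣ : ∣ image G V - s x ∣ < ∣ V ∣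
  ∣image-sx∣<∣V∣ = subst (∣ image G V - s x ∣ <_) crit (x∈p⇒∣p-x∣<∣p∣ sx∈)

-- prefix W i is definitionally blocksBelow W (toℕ i); the ℕ index is what the induction runs on.
blocksBelow : ∀ {n m} → (Fin m → Subset n) → ℕ → Subset n
blocksBelow W t = ⋃[ (λ j → toℕ j <ᵇ t) ∣ W ]

module _ {n m : ℕ} (W : Fin m → Subset n) where

  ∈-blocksBelow⁻ : ∀ t {x} → x ∈ blocksBelow W t → ∃ λ j → toℕ j < t × x ∈ W j
  ∈-blocksBelow⁻ t x∈ with ∈-⋃[∣]⁻ (λ j → toℕ j <ᵇ t) W x∈
  ... | j , j<ᵇt , x∈Wj = j , <ᵇ⇒< (toℕ j) t j<ᵇt , x∈Wj

  ∈-blocksBelow⁺ : ∀ t {x} j → toℕ j < t → x ∈ W j → x ∈ blocksBelow W t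
  ∈-blocksBelow⁺ t j j<t = ∈-⋃[∣]⁺ (λ j → toℕ j <ᵇ t) W (<⇒<ᵇ j<t)

  ∈-suffix⁻ : ∀ i {x} → x ∈ suffix W i → ∃ λ j → toℕ i ≤ toℕ j × x ∈ W j
  ∈-suffix⁻ i x∈ with ∈-⋃[∣]⁻ (λ j → toℕ i ≤ᵇ toℕ j) W x∈
  ... | j , i≤ᵇj , x∈Wj = j , ≤ᵇ⇒≤ (toℕ i) (toℕ j) i≤ᵇj , x∈Wj

  ∈-suffix⁺ : ∀ i {x} j → toℕ i ≤ toℕ j → x ∈ W j → x ∈ suffix W i
  ∈-suffix⁺ i j i≤j = ∈-⋃[∣]⁺ (λ j → toℕ i ≤ᵇ toℕ j) W (≤⇒≤ᵇ i≤j)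

  blocksBelow-mono : ∀ {t u x} → t ≤ u → x ∈ blocksBelow W t → x ∈ blocksBelow W u
  blocksBelow-mono {t} {u} t≤u x∈ with ∈-blocksBelow⁻ t x∈
  ... | j , j<t , x∈Wj = ∈-blocksBelow⁺ u j (<-≤-trans j<t t≤u) x∈Wj

  ∈-blocksBelow-suc⁻ : ∀ t {x} → x ∈ blocksBelow W (suc t)
                     → x ∈ blocksBelow W t ⊎ ∃ λ j → toℕ j ≡ t × x ∈ W j
  ∈-blocksBelow-suc⁻ t x∈ with ∈-blocksBelow⁻ (suc t) x∈
  ... | j , j<1+t , x∈Wj with m<1+n⇒m<n∨m≡n j<1+t
  ...   | inj₁ j<t = inj₁ (∈-blocksBelow⁺ t j j<t x∈Wj)
  ...   | inj₂ j≡t = inj₂ (j , j≡t , x∈Wj)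

module _ {n k m : ℕ} {F : SetValued n k} {W : Fin m → Subset n} (H : HallPartition F W) where
  open HallPartition H

  ∉-blocksBelow : ∀ j {x} → x ∈ W j → x ∉ blocksBelow W (toℕ j)
  ∉-blocksBelow j x∈Wj x∈ with ∈-blocksBelow⁻ W (toℕ j) x∈
  ... | j′ , j′<j , x∈Wj′ with disjoint j j′ _ x∈Wj x∈Wj′
  ...   | refl = <-irrefl refl j′<j

  ∈-suffix⇔∉-prefix : ∀ i x → x ∈ suffix W i ⇔ x ∉ prefix W i
  ∈-suffix⇔∉-prefix i x = mk⇔ to from
    where
    to : x ∈ suffix W i → x ∉ prefix W i
    to x∈suf x∈pre with ∈-suffix⁻ W i x∈suf
    ... | j , i≤j , x∈Wj = ∉-blocksBelow j x∈Wj (blocksBelow-mono W i≤j x∈pre)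
    from : x ∉ prefix W i → x ∈ suffix W i
    from x∉pre with covers x
    ... | j , x∈Wj with toℕ i ≤? toℕ j
    ...   | yes i≤j = ∈-suffix⁺ W i j i≤j x∈Wj
    ...   | no  i≰j = contradiction (∈-blocksBelow⁺ W (toℕ i) j (≰⇒> i≰j) x∈Wj) x∉pre

  module _ {s : Fin n → Fin k} (sel : IsSelectionOn ⊤ F s) (inj : AllDifferentOn ⊤ s) where

    AvoidsImageBelow : ℕ → Set
    AvoidsImageBelow t = ∀ x → x ∉ blocksBelow W t → s x ∉ image F (blocksBelow W t)

    avoidsImageBelow-suc : ∀ t → suc t < m → AvoidsImageBelow t → AvoidsImageBelow (suc t)
    avoidsImageBelow-suc t 1+t<m avoids x x∉ sx∈ with s x ∈? image F (blocksBelow W t)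
    ... | yes sx∈below = avoids x (x∉ ∘ blocksBelow-mono W (n≤1+n t)) sx∈below
    ... | no  sx∉below with ∈-image⁻ F (blocksBelow W (suc t)) sx∈
    ...   | y , y∈ , sx∈Fy with ∈-blocksBelow-suc⁻ W t y∈
    ...     | inj₁ y∈below = sx∉below (∈-image⁺ F y∈below sx∈Fy)
    ...     | inj₂ (j , refl , y∈Wj) =
      critical⇒∉image (reduce F (blocksBelow W t)) (W j) s (proj₂ (cond-iii j 1+t<m))
        (λ a a∈Wj → x∈p∧x∉q⇒x∈p─q (sel a ∈⊤) (avoids a (∉-blocksBelow j a∈Wj)))
        inj x (x∉ ∘ ∈-blocksBelow⁺ W (suc t) j (n<1+n t))
        (∈-image-reduce F (blocksBelow W t) (W j) (∈-image⁺ F y∈Wj sx∈Fy) sx∉below)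

    avoidsImageBelow : ∀ t → t < m → AvoidsImageBelow t
    avoidsImageBelow zero    _   x _ sx∈ with ∈-image⁻ F (blocksBelow W 0) sx∈
    ... | y , y∈ , _ with ∈-blocksBelow⁻ W 0 y∈
    ...   | _ , () , _
    avoidsImageBelow (suc t) t<m =
      avoidsImageBelow-suc t t<m (avoidsImageBelow t (<-trans (n<1+n t) t<m))

lemma4p6 : (n k m : ℕ) (F : SetValued (suc n) (suc k)) (W : Fin m → Subset (suc n))
    → HallPartition F W
    → (s : Fin (suc n) → Fin (suc k))
    → IsSelectionOn ⊤ F s → AllDifferentOn ⊤ s
    → ∀ i → (∀ x → x ∈ suffix W i ⇔ x ∉ prefix W i)
      × IsSelectionOn (suffix W i) (reduce F (prefix W i)) s
      × AllDifferentOn (suffix W i) s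
lemma4p6 n k m F W H s sel inj i = suffix⇔ , selectionOnSuffix , λ x y _ _ → inj x y ∈⊤ ∈⊤
  where
  suffix⇔ : ∀ x → x ∈ suffix W i ⇔ x ∉ prefix W i
  suffix⇔ = ∈-suffix⇔∉-prefix H i
  selectionOnSuffix : IsSelectionOn (suffix W i) (reduce F (prefix W i)) s
  selectionOnSuffix x x∈ = x∈p∧x∉q⇒x∈p─q (sel x ∈⊤)
    (avoidsImageBelow H sel inj (toℕ i) (toℕ<n i) x (Equivalence.to (suffix⇔ x) x∈))
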